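{- Let $U$ be a signed unicyclic graph of order $n$ with unique cycle $C$. Then $\eta(U)=1$ if $m^+(C)\neq m^-(C)$, and $\eta(U)=2$ otherwise.
   Context: A signed graph $\Gamma=(G,\sigma)$ is a simple graph $G$ with a sign function $\sigma:E(G)\to\{ -1,+1\}$. A signed unicyclic graph is a connected signed graph with $|E|=|V|$, i.e. containing exactly one cycle. The net Laplacian matrix is $L^{\pm}(\Gamma)=D^{\pm}(\Gamma)-A(\Gamma)$, where $D^{\pm}(\Gamma)$ is the diagonal matrix of net-degrees $d^{\pm}(v)=d^+(v)-d^-(v)$ (numbers of positive minus negative neighbours) and $A(\Gamma)$ is the signed adjacency matrix. $\eta(\Gamma)$ is the multiplicity of $0$ as an eigenvalue of $L^{\pm}(\Gamma)$. $m^+(C)$ and $m^-(C)$ are the numbers of positive and negative edges of $C$. -}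

module Defs where

open import Data.Nat as ℕ using (ℕ; zero; suc; _≤_)
open import Data.Nat.DivMod using (_mod_)
open import Data.Fin as Fin using (Fin; toℕ)
open import Data.Integer as ℤ using (ℤ; +_; -[1+_])
open import Data.Rational as ℚ using (ℚ; 0ℚ)
open import Data.Bool using (Bool; true; false; _∧_; not)
open import Data.Product using (Σ; _×_; _,_)
open import Data.Sum using (_⊎_)
open import Relation.Nullary using (¬_)
open import Relation.Nullary.Decidable using (⌊_⌋)
open import Relation.Binary.PropositionalEquality using (_≡_; _≢_)

count : ∀ {n} → (Fin n → Bool) → ℕ
count {zero}  p = 0
count {suc n} p = (if p Fin.zero then 1 else 0) ℕ.+ count (λ i → p (Fin.suc i))
  where open import Data.Bool using (if_then_else_)

sumℚ : ∀ {n} → (Fin n → ℚ) → ℚ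
sumℚ {zero}  f = 0ℚ
sumℚ {suc n} f = f Fin.zero ℚ.+ sumℚ (λ i → f (Fin.suc i))

-- Signed graphs on vertex set Fin n, given by their signed adjacency
-- matrix: A i j = +1 (positive edge), -1 (negative edge), 0 (no edge).

record SignedGraph (n : ℕ) : Set where
  field
    A         : Fin n → Fin n → ℤ
    entries   : ∀ i j → (A i j ≡ + 1) ⊎ (A i j ≡ -[1+ 0 ]) ⊎ (A i j ≡ + 0)
    symmetric : ∀ i j → A i j ≡ A j i
    loopless  : ∀ i → A i i ≡ + 0
open SignedGraph public

Adjacent : ∀ {n} → SignedGraph n → Fin n → Fin n → Set
Adjacent Γ i j = A Γ i j ≢ + 0

isPos isNeg isEdge : ℤ → Bool
isPos  x = ⌊ x ℤ.≟ + 1 ⌋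
isNeg  x = ⌊ x ℤ.≟ -[1+ 0 ] ⌋
isEdge x = not ⌊ x ℤ.≟ + 0 ⌋

edgeCount : ∀ {n} → SignedGraph n → ℕ
edgeCount Γ = sumℕ (λ i → count (λ j → ⌊ i Fin.<? j ⌋ ∧ isEdge (A Γ i j)))
  where
  sumℕ : ∀ {n} → (Fin n → ℕ) → ℕ
  sumℕ {zero}  f = 0
  sumℕ {suc n} f = f Fin.zero ℕ.+ sumℕ (λ i → f (Fin.suc i))

data Walk {n} (Γ : SignedGraph n) : Fin n → Fin n → Set where
  here : ∀ {i} → Walk Γ i i
  step : ∀ {i j k} → Adjacent Γ i j → Walk Γ j k → Walk Γ i k

Connected : ∀ {n} → SignedGraph n → Set
Connected Γ = ∀ i j → Walk Γ i j

Unicyclic : ∀ {n} → SignedGraph n → Set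
Unicyclic {n} Γ = Connected Γ × edgeCount Γ ≡ n

record Cycle {n} (Γ : SignedGraph n) : Set where
  field
    m     : ℕ
    verts : Fin (3 ℕ.+ m) → Fin n
    inj   : ∀ i j → verts i ≡ verts j → i ≡ j
    adj   : ∀ i → Adjacent Γ (verts i) (verts ((suc (toℕ i)) mod (3 ℕ.+ m)))
open Cycle public

cycleEdgeSign : ∀ {n} {Γ : SignedGraph n} (C : Cycle Γ) → Fin (3 ℕ.+ m C) → ℤ
cycleEdgeSign {Γ = Γ} C i = A Γ (verts C i) (verts C ((suc (toℕ i)) mod (3 ℕ.+ m C)))

m⁺ m⁻ : ∀ {n} {Γ : SignedGraph n} → Cycle Γ → ℕ
m⁺ C = count (λ i → isPos (cycleEdgeSign C i))
m⁻ C = count (λ i → isNeg (cycleEdgeSign C i))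

netDegree : ∀ {n} → SignedGraph n → Fin n → ℤ
netDegree Γ v = + count (λ j → isPos (A Γ v j)) ℤ.- + count (λ j → isNeg (A Γ v j))

netLaplacian : ∀ {n} → SignedGraph n → Fin n → Fin n → ℤ
netLaplacian Γ i j with i Fin.≟ j
... | Relation.Nullary.yes _ = netDegree Γ i ℤ.- A Γ i j
... | Relation.Nullary.no  _ = ℤ.- A Γ i j

-- For the real symmetric matrix L±, the multiplicity of the eigenvalue 0
-- equals dim ker L±, and the kernel dimension of an integer matrix is the
-- same over ℚ and over ℝ.

toℚ : ℤ → ℚ
toℚ z = z ℚ./ 1

Kernel : ∀ {n} → (Fin n → Fin n → ℤ) → (Fin n → ℚ) → Set
Kernel M x = ∀ i → sumℚ (λ j → toℚ (M i j) ℚ.* x j) ≡ 0ℚ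

HasNullity : ∀ {n} → (Fin n → Fin n → ℤ) → ℕ → Set
HasNullity {n} M k =
  Σ (Fin k → Fin n → ℚ) λ b →
    (∀ t → Kernel M (b t))
  × (∀ (c : Fin k → ℚ) → (∀ i → sumℚ (λ t → c t ℚ.* b t i) ≡ 0ℚ) → ∀ t → c t ≡ 0ℚ)
  × (∀ x → Kernel M x → Σ (Fin k → ℚ) λ c → ∀ i → x i ≡ sumℚ (λ t → c t ℚ.* b t i))

η≡ : ∀ {n} → SignedGraph n → ℕ → Set
η≡ Γ k = HasNullity (netLaplacian Γ) k

{-# OPTIONS --safe #-}
module Submission where

-- Give every vertex u an out-neighbour out u: the next vertex along C if u lies on C, and a
-- neighbour closer to C otherwise. The n edges {u, out u} are distinct, so as |E| = n they are
-- all the edges of U. Writing flow x u = σ(u, out u) (x u - x (out u)), the row of L± x at u is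
-- the flow out of u minus the flow into u. A kernel vector therefore conserves flow: the flow
-- vanishes on the trees hanging off C and equals a constant c along C. As σ² = 1, the edge
-- differences x(vᵢ) - x(vᵢ₊₁) = σᵢ c sum to zero around C, so c (m⁺ - m⁻) = 0. If m⁺ ≠ m⁻ then
-- c = 0 and x is constant. If m⁺ = m⁻ there is a potential with flow 1 around C, and it spans
-- the kernel together with the constants.

open import Defs
open import Algebra.Bundles using (Monoid; CommutativeMonoid; CommutativeRing)
import Algebra.Properties.Monoid.Sum as MonoidSum
import Algebra.Properties.CommutativeMonoid.Sum as CommutativeMonoidSum
import Algebra.Properties.Semiring.Sum as SemiringSum
open import Data.Bool using (Bool; if_then_else_; _∧_)
open import Data.Empty using (⊥-elim)
open import Data.Fin as Fin using (Fin; zero; suc; toℕ; inject₁; fromℕ; _≟_; _<?_)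
import Data.Fin.Properties as FinP
open import Data.Fin.Induction using (<-weakInduction)
open import Data.Integer as ℤ using (ℤ; +_; -[1+_])
open import Data.Integer.GCD using (gcd)
import Data.Integer.Properties as ℤP
open import Data.Nat as ℕ using (ℕ; _≤_; _<_; z≤n; s≤s)
import Data.Nat.Properties as ℕP
open import Data.Nat.DivMod using (_mod_; m<n⇒m%n≡m; n%n≡0)
open import Data.Product using (∃; _×_; _,_; proj₁; proj₂)
open import Data.Rational as ℚ using (ℚ; 0ℚ; 1ℚ; _+_; _*_; -_; _-_)
import Data.Rational.Properties as ℚP
open import Data.Rational.Unnormalised as ℚᵘ using (mkℚᵘ; *≡*)
import Data.Rational.Unnormalised.Properties as ℚᵘP
open import Data.Rational.Solver using (module +-*-Solver)
open import Data.Sum using (_⊎_; inj₁; inj₂)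
open import Function using (_∘_)
open import Relation.Binary.Definitions using (tri<; tri≈; tri>)
open import Relation.Binary.PropositionalEquality
open import Relation.Nullary using (¬_; Dec; yes; no; does)
open import Relation.Nullary.Decidable using (⌊_⌋; _⊎-dec_; _×-dec_; ¬?)

module _ {c ℓ} (M : Monoid c ℓ) where
  open Monoid M using (Carrier; _≈_; ε; ∙-congˡ; identityˡ; identityʳ) renaming (trans to ≈-trans)
  open MonoidSum M using (sum; sum-replicate-zero)

  sum-δ : ∀ {n} (i : Fin n) (f : Fin n → Carrier) →
          sum (λ j → if does (j ≟ i) then f j else ε) ≈ f i
  sum-δ {ℕ.suc n} zero    f = ≈-trans (∙-congˡ (sum-replicate-zero n)) (identityʳ (f zero))
  sum-δ           (suc i) f = ≈-trans (identityˡ _) (sum-δ i (f ∘ suc))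

module ℕΣ = CommutativeMonoidSum ℕP.+-0-commutativeMonoid

sum-const-1 : ∀ n → ℕΣ.sum {n} (λ _ → 1) ≡ n
sum-const-1 ℕ.zero    = refl
sum-const-1 (ℕ.suc n) = cong ℕ.suc (sum-const-1 n)

sum-mono-≤ : ∀ {n} {f g : Fin n → ℕ} → (∀ i → f i ≤ g i) → ℕΣ.sum f ≤ ℕΣ.sum g
sum-mono-≤ {ℕ.zero}  f≤g = z≤n
sum-mono-≤ {ℕ.suc n} f≤g = ℕP.+-mono-≤ (f≤g zero) (sum-mono-≤ (f≤g ∘ suc))

≤-sum : ∀ {n} (f : Fin n → ℕ) i → f i ≤ ℕΣ.sum f
≤-sum f zero    = ℕP.m≤m+n _ _
≤-sum f (suc i) = ℕP.≤-trans (≤-sum (f ∘ suc) i) (ℕP.m≤n+m _ (f zero))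

sum-squeeze : ∀ {n} {f g : Fin n → ℕ} → (∀ i → f i ≤ g i) → ℕΣ.sum g ≤ ℕΣ.sum f →
              ∀ i → f i ≡ g i
sum-squeeze {ℕ.suc n} {f} {g} f≤g Σg≤Σf = λ
  { zero    → ℕP.≤-antisym (f≤g zero) head-≥
  ; (suc i) → sum-squeeze (f≤g ∘ suc) tail-≥ i }
  where
  head-≥ : g zero ≤ f zero
  head-≥ = ℕP.+-cancelʳ-≤ _ _ _ (ℕP.≤-trans Σg≤Σf (ℕP.+-monoʳ-≤ (f zero) (sum-mono-≤ (f≤g ∘ suc))))
  tail-≥ : ℕΣ.sum (g ∘ suc) ≤ ℕΣ.sum (f ∘ suc)
  tail-≥ = ℕP.+-cancelˡ-≤ _ _ _ (ℕP.≤-trans Σg≤Σf (ℕP.+-monoˡ-≤ _ (f≤g zero)))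

doubleSum : ∀ {n} → (Fin n → Fin n → ℕ) → ℕ
doubleSum f = ℕΣ.sum (λ u → ℕΣ.sum (f u))

doubleSum-cong : ∀ {n} {f g : Fin n → Fin n → ℕ} → (∀ u j → f u j ≡ g u j) → doubleSum f ≡ doubleSum g
doubleSum-cong {n} f≡g = ℕΣ.sum-cong-≗ {n} (λ u → ℕΣ.sum-cong-≗ {n} (f≡g u))

doubleSum-symmetrise : ∀ {n} (f : Fin n → Fin n → ℕ) →
                       doubleSum (λ u j → f u j ℕ.+ f j u) ≡ doubleSum f ℕ.+ doubleSum f
doubleSum-symmetrise {n} f = begin
  doubleSum (λ u j → f u j ℕ.+ f j u)
    ≡⟨ ℕΣ.sum-cong-≗ {n} (λ u → ℕΣ.∑-distrib-+ (f u) (λ j → f j u)) ⟩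
  ℕΣ.sum (λ u → ℕΣ.sum (f u) ℕ.+ ℕΣ.sum (λ j → f j u))
    ≡⟨ ℕΣ.∑-distrib-+ (λ u → ℕΣ.sum (f u)) (λ u → ℕΣ.sum (λ j → f j u)) ⟩
  doubleSum f ℕ.+ doubleSum (λ u j → f j u)
    ≡⟨ cong (ℕ._+_ (doubleSum f)) (sym (ℕΣ.∑-comm f)) ⟩
  doubleSum f ℕ.+ doubleSum f ∎
  where open ≡-Reasoning

doubleSum-squeeze : ∀ {n} {f g : Fin n → Fin n → ℕ} → (∀ u j → f u j ≤ g u j) →
                    doubleSum g ≤ doubleSum f → ∀ u j → f u j ≡ g u j
doubleSum-squeeze f≤g Σg≤Σf u = sum-squeeze (f≤g u)
  (ℕP.≤-reflexive (sym (sum-squeeze (λ w → sum-mono-≤ (f≤g w)) Σg≤Σf u)))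

doubleSum-rows≡1 : ∀ {n} {f : Fin n → Fin n → ℕ} → (∀ u → ℕΣ.sum (f u) ≡ 1) → doubleSum f ≡ n
doubleSum-rows≡1 {n} rows≡1 = trans (ℕΣ.sum-cong-≗ {n} rows≡1) (sum-const-1 n)

data LastOrInject {K : ℕ} : Fin (ℕ.suc K) → Set where
  last   : LastOrInject (fromℕ K)
  inject : (i : Fin K) → LastOrInject (inject₁ i)

lastOrInject : ∀ {K} (i : Fin (ℕ.suc K)) → LastOrInject i
lastOrInject {ℕ.zero}  zero    = last
lastOrInject {ℕ.suc K} zero    = inject zero
lastOrInject {ℕ.suc K} (suc i) with lastOrInject i
... | last     = last
... | inject j = inject (suc j)

module _ {K : ℕ} where

  -- Definitionally the successor (suc (toℕ i)) mod (3 + m) of Defs.Cycle when K = 2 + m.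
  next : Fin (ℕ.suc K) → Fin (ℕ.suc K)
  next i = ℕ.suc (toℕ i) mod ℕ.suc K

  prev : Fin (ℕ.suc K) → Fin (ℕ.suc K)
  prev zero    = fromℕ K
  prev (suc i) = inject₁ i

  toℕ-next : ∀ i → toℕ (next i) ≡ ℕ.suc (toℕ i) ℕ.% ℕ.suc K
  toℕ-next i = FinP.toℕ-fromℕ< _

  next-inject₁ : ∀ i → next (inject₁ i) ≡ suc i
  next-inject₁ i = FinP.toℕ-injective (begin
    toℕ (next (inject₁ i))              ≡⟨ toℕ-next (inject₁ i) ⟩
    ℕ.suc (toℕ (inject₁ i)) ℕ.% ℕ.suc K ≡⟨ m<n⇒m%n≡m (s≤s (FinP.inject₁ℕ< i)) ⟩
    ℕ.suc (toℕ (inject₁ i))             ≡⟨ cong ℕ.suc (FinP.toℕ-inject₁ i) ⟩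
    ℕ.suc (toℕ i)                       ∎)
    where open ≡-Reasoning

  next-fromℕ : next (fromℕ K) ≡ zero
  next-fromℕ = FinP.toℕ-injective (begin
    toℕ (next (fromℕ K))                ≡⟨ toℕ-next (fromℕ K) ⟩
    ℕ.suc (toℕ (fromℕ K)) ℕ.% ℕ.suc K   ≡⟨ cong (λ t → ℕ.suc t ℕ.% ℕ.suc K) (FinP.toℕ-fromℕ K) ⟩
    ℕ.suc K ℕ.% ℕ.suc K                 ≡⟨ n%n≡0 (ℕ.suc K) ⟩
    0                                   ∎)
    where open ≡-Reasoning

  next-prev : ∀ i → next (prev i) ≡ i
  next-prev zero    = next-fromℕ
  next-prev (suc i) = next-inject₁ i

  next-injective : ∀ {i j} → next i ≡ next j → i ≡ j
  next-injective {i} {j} e with lastOrInject i | lastOrInject j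
  ... | last      | last      = refl
  ... | last      | inject j′ with () ← trans (sym next-fromℕ) (trans e (next-inject₁ j′))
  ... | inject i′ | last      with () ← trans (sym next-fromℕ) (trans (sym e) (next-inject₁ i′))
  ... | inject i′ | inject j′ =
    cong inject₁ (FinP.suc-injective (trans (sym (next-inject₁ i′)) (trans e (next-inject₁ j′))))

  next-invariant⇒constant : ∀ {a} {A : Set a} (g : Fin (ℕ.suc K) → A) →
                            (∀ i → g (next i) ≡ g i) → ∀ i → g i ≡ g zero
  next-invariant⇒constant g g∘next≗g = <-weakInduction (λ i → g i ≡ g zero) refl
    (λ i gi≡g0 → trans (cong g (sym (next-inject₁ i))) (trans (g∘next≗g (inject₁ i)) gi≡g0))

next∘next≢id : ∀ {m} (i : Fin (3 ℕ.+ m)) → next (next i) ≢ i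
next∘next≢id i e with lastOrInject i
... | last with () ← trans (sym (trans (cong next next-fromℕ) (next-inject₁ zero))) e
... | inject j with lastOrInject j
...   | last with () ← trans (sym (trans (cong next (next-inject₁ j)) next-fromℕ)) e
...   | inject j′ = ℕP.<⇒≢ (ℕP.m<n+m (toℕ j′) (s≤s z≤n)) (sym (begin
  2 ℕ.+ toℕ j′
    ≡⟨ cong toℕ (sym (trans (cong next (next-inject₁ j)) (next-inject₁ (suc j′)))) ⟩
  toℕ (next (next i))
    ≡⟨ cong toℕ e ⟩
  toℕ (inject₁ (inject₁ j′))
    ≡⟨ trans (FinP.toℕ-inject₁ _) (FinP.toℕ-inject₁ j′) ⟩
  toℕ j′ ∎))
  where open ≡-Reasoning

module _ {c ℓ} (M : CommutativeMonoid c ℓ) where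
  open CommutativeMonoid M using (Carrier; _≈_; _∙_; comm)
    renaming (trans to ≈-trans; reflexive to ≈-reflexive)
  open CommutativeMonoidSum M using (sum; sum-init-last; sum-cong-≗)

  sum-next : ∀ {K} (f : Fin (ℕ.suc K) → Carrier) → sum (f ∘ next) ≈ sum f
  sum-next f = ≈-trans (sum-init-last (f ∘ next))
    (≈-trans (≈-reflexive (cong₂ _∙_ (sum-cong-≗ (cong f ∘ next-inject₁)) (cong f next-fromℕ)))
             (comm _ _))

module ℚΣ = CommutativeMonoidSum ℚP.+-0-commutativeMonoid
open ℚΣ using (sum; sum-syntax; sum-cong-≗; ∑-distrib-+)
open SemiringSum (CommutativeRing.semiring ℚP.+-*-commutativeRing) using (*-distribˡ-sum; *-distribʳ-sum)
open import Algebra.Properties.Group ℚP.+-0-group using (⁻¹-involutive; x∙y⁻¹≈ε⇒x≈y)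
open +-*-Solver using (solve; _:+_; _:-_; _:*_; :-_; _:=_; con)

sumℚ≡sum : ∀ {n} (f : Fin n → ℚ) → sumℚ f ≡ sum f
sumℚ≡sum {ℕ.zero}  f = refl
sumℚ≡sum {ℕ.suc n} f = cong (_+_ (f zero)) (sumℚ≡sum (f ∘ suc))

sum-neg : ∀ {n} (f : Fin n → ℚ) → sum (λ i → - f i) ≡ - sum f
sum-neg {ℕ.zero}  f = refl
sum-neg {ℕ.suc n} f =
  trans (cong (_+_ (- f zero)) (sum-neg (f ∘ suc))) (sym (ℚP.neg-distrib-+ (f zero) _))

sum-sub : ∀ {n} (f g : Fin n → ℚ) → sum (λ i → f i - g i) ≡ sum f - sum g
sum-sub f g = trans (∑-distrib-+ f (λ i → - g i)) (cong (_+_ (sum f)) (sum-neg g))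

sum-zero : ∀ {n} {f : Fin n → ℚ} → (∀ i → f i ≡ 0ℚ) → sum f ≡ 0ℚ
sum-zero {n} f≡0 = trans (sum-cong-≗ {n} f≡0) (ℚΣ.sum-replicate-zero n)

when : ∀ {p} {P : Set p} → Dec P → ℚ → ℚ
when P? q = if does P? then q else 0ℚ

when-⇔ : ∀ {p q} {P : Set p} {Q : Set q} (P? : Dec P) (Q? : Dec Q) →
         (P → Q) → (Q → P) → ∀ r → when P? r ≡ when Q? r
when-⇔ (yes _) (yes _) _   _   r = refl
when-⇔ (no _)  (no _)  _   _   r = refl
when-⇔ (yes p) (no ¬q) p→q _   r = ⊥-elim (¬q (p→q p))
when-⇔ (no ¬p) (yes q) _   q→p r = ⊥-elim (¬p (q→p q))

when-0 : ∀ {p} {P : Set p} (P? : Dec P) → when P? 0ℚ ≡ 0ℚ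
when-0 (yes _) = refl
when-0 (no _)  = refl

sum-when-≡ : ∀ {n} (i : Fin n) (f : Fin n → ℚ) → sum (λ j → when (j ≟ i) (f j)) ≡ f i
sum-when-≡ = sum-δ ℚP.+-0-monoid

*-cancel-square≡1 : ∀ w → w * w ≡ 1ℚ → ∀ p → w * (w * p) ≡ p
*-cancel-square≡1 w w²≡1 p = trans (sym (ℚP.*-assoc w w p)) (trans (cong (_* p) w²≡1) (ℚP.*-identityˡ p))

p*q≡0⇒p≡0 : ∀ {p q} → q ≢ 0ℚ → p * q ≡ 0ℚ → p ≡ 0ℚ
p*q≡0⇒p≡0 {p} {q} q≢0 pq≡0 = begin
  p                  ≡⟨ sym (ℚP.*-identityʳ p) ⟩
  p * 1ℚ             ≡⟨ cong (p *_) (sym (ℚP.*-inverseʳ q)) ⟩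
  p * (q * ℚ.1/ q)   ≡⟨ sym (ℚP.*-assoc p q _) ⟩
  (p * q) * ℚ.1/ q   ≡⟨ cong (_* ℚ.1/ q) pq≡0 ⟩
  0ℚ * ℚ.1/ q        ≡⟨ ℚP.*-zeroˡ (ℚ.1/ q) ⟩
  0ℚ                 ∎
  where
  open ≡-Reasoning
  instance
    q-nonZero : ℚ.NonZero q
    q-nonZero = ℚ.≢-nonZero q≢0

prefixSum : ∀ {k} → (Fin k → ℚ) → Fin (ℕ.suc k) → ℚ
prefixSum           f zero    = 0ℚ
prefixSum {ℕ.suc k} f (suc i) = f zero + prefixSum (f ∘ suc) i

prefixSum-suc : ∀ {k} (f : Fin k → ℚ) i → prefixSum f (suc i) ≡ prefixSum f (inject₁ i) + f i
prefixSum-suc f zero    = trans (ℚP.+-identityʳ (f zero)) (sym (ℚP.+-identityˡ (f zero)))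
prefixSum-suc f (suc i) = trans (cong (_+_ (f zero)) (prefixSum-suc (f ∘ suc) i))
  (sym (ℚP.+-assoc (f zero) (prefixSum (f ∘ suc) (inject₁ i)) (f (suc i))))

prefixSum-fromℕ : ∀ {k} (f : Fin k → ℚ) → prefixSum f (fromℕ k) ≡ sum f
prefixSum-fromℕ {ℕ.zero}  f = refl
prefixSum-fromℕ {ℕ.suc k} f = cong (_+_ (f zero)) (prefixSum-fromℕ (f ∘ suc))

cyclic-potential : ∀ {K} (f : Fin (ℕ.suc K) → ℚ) → sum f ≡ 0ℚ →
                   ∃ λ P → P zero ≡ 0ℚ × (∀ i → P i - P (next i) ≡ f i)
cyclic-potential {K} f Σf≡0 = P , refl , P-step
  where
  P : Fin (ℕ.suc K) → ℚ
  P i = - prefixSum f (inject₁ i)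
  P-step : ∀ i → P i - P (next i) ≡ f i
  P-step i with lastOrInject i
  ... | inject j rewrite next-inject₁ j | prefixSum-suc f (inject₁ j) =
    solve 2 (λ a b → (:- a) :- (:- (a :+ b)) := b) refl (prefixSum f (inject₁ (inject₁ j))) (f (inject₁ j))
  ... | last rewrite next-fromℕ {K} = begin
    - a - 0ℚ      ≡⟨ solve 2 (λ a b → (:- a) :- con 0ℚ := b :- (a :+ b)) refl a b ⟩
    b - (a + b)   ≡⟨ cong (_-_ b) (trans (sym (prefixSum-suc f (fromℕ K))) (trans (prefixSum-fromℕ f) Σf≡0)) ⟩
    b - 0ℚ        ≡⟨ ℚP.+-identityʳ b ⟩
    b             ∎
    where
    open ≡-Reasoning
    a = prefixSum f (inject₁ (fromℕ K))
    b = f (fromℕ K)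

toℚ-+ : ∀ a b → toℚ (a ℤ.+ b) ≡ toℚ a + toℚ b
toℚ-+ a b = ℚP.toℚᵘ-injective (begin
  ℚ.toℚᵘ (toℚ (a ℤ.+ b))
    ≈⟨ ℚP.toℚᵘ-fromℚᵘ (mkℚᵘ (a ℤ.+ b) 0) ⟩
  mkℚᵘ (a ℤ.+ b) 0
    ≈⟨ *≡* (cong (ℤ._* + 1) (cong₂ ℤ._+_ (sym (ℤP.*-identityʳ a)) (sym (ℤP.*-identityʳ b)))) ⟩
  mkℚᵘ a 0 ℚᵘ.+ mkℚᵘ b 0
    ≈⟨ ℚᵘP.+-cong (ℚᵘP.≃-sym (ℚP.toℚᵘ-fromℚᵘ (mkℚᵘ a 0)))
                  (ℚᵘP.≃-sym (ℚP.toℚᵘ-fromℚᵘ (mkℚᵘ b 0))) ⟩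
  ℚ.toℚᵘ (toℚ a) ℚᵘ.+ ℚ.toℚᵘ (toℚ b)
    ≈⟨ ℚᵘP.≃-sym (ℚP.toℚᵘ-homo-+ (toℚ a) (toℚ b)) ⟩
  ℚ.toℚᵘ (toℚ a + toℚ b) ∎)
  where open ℚᵘP.≃-Reasoning

toℚ-neg : ∀ a → toℚ (ℤ.- a) ≡ - toℚ a
toℚ-neg (+ ℕ.zero)  = refl
toℚ-neg (+ ℕ.suc n) = refl
toℚ-neg -[1+ n ]    = sym (⁻¹-involutive (toℚ (+ ℕ.suc n)))

toℚ-sub : ∀ a b → toℚ (a ℤ.- b) ≡ toℚ a - toℚ b
toℚ-sub a b = trans (toℚ-+ a (ℤ.- b)) (cong (_+_ (toℚ a)) (toℚ-neg b))

toℚ≡0⇒≡0 : ∀ a → toℚ a ≡ 0ℚ → a ≡ + 0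
toℚ≡0⇒≡0 a toℚa≡0 = trans (sym (ℚP.↥-/ a 1)) (cong (λ p → ℚ.↥ p ℤ.* gcd a (+ 1)) toℚa≡0)

sum-toℚ-count : ∀ {n} (p : Fin n → Bool) → sum (λ j → toℚ (+ (if p j then 1 else 0))) ≡ toℚ (+ count p)
sum-toℚ-count {ℕ.zero}  p = refl
sum-toℚ-count {ℕ.suc n} p = trans (cong (_+_ (toℚ p₀)) (sum-toℚ-count (p ∘ suc)))
                                  (sym (toℚ-+ p₀ (+ count (p ∘ suc))))
  where p₀ = + (if p zero then 1 else 0)

sum-signs : ∀ {n} (f : Fin n → ℤ) → (∀ j → (f j ≡ + 1) ⊎ (f j ≡ -[1+ 0 ]) ⊎ (f j ≡ + 0)) →
            sum (toℚ ∘ f) ≡ toℚ (+ count (isPos ∘ f) ℤ.- + count (isNeg ∘ f))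
sum-signs {n} f signs = begin
  sum (toℚ ∘ f)
    ≡⟨ sum-cong-≗ {n} (λ j → split (signs j)) ⟩
  ∑[ j < n ] (toℚ (+ 𝟙 (isPos (f j))) - toℚ (+ 𝟙 (isNeg (f j))))
    ≡⟨ sum-sub (λ j → toℚ (+ 𝟙 (isPos (f j)))) (λ j → toℚ (+ 𝟙 (isNeg (f j)))) ⟩
  ∑[ j < n ] toℚ (+ 𝟙 (isPos (f j))) - ∑[ j < n ] toℚ (+ 𝟙 (isNeg (f j)))
    ≡⟨ cong₂ _-_ (sum-toℚ-count (isPos ∘ f)) (sum-toℚ-count (isNeg ∘ f)) ⟩
  toℚ (+ count (isPos ∘ f)) - toℚ (+ count (isNeg ∘ f))
    ≡⟨ sym (toℚ-sub (+ count (isPos ∘ f)) (+ count (isNeg ∘ f))) ⟩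
  toℚ (+ count (isPos ∘ f) ℤ.- + count (isNeg ∘ f)) ∎
  where
  open ≡-Reasoning
  𝟙 : Bool → ℕ
  𝟙 b = if b then 1 else 0
  split : ∀ {x} → (x ≡ + 1) ⊎ (x ≡ -[1+ 0 ]) ⊎ (x ≡ + 0) →
          toℚ x ≡ toℚ (+ 𝟙 (isPos x)) - toℚ (+ 𝟙 (isNeg x))
  split (inj₁ refl)        = refl
  split (inj₂ (inj₁ refl)) = refl
  split (inj₂ (inj₂ refl)) = refl

count≡sum : ∀ {n} (p : Fin n → Bool) → count p ≡ ℕΣ.sum (λ j → if p j then 1 else 0)
count≡sum {ℕ.zero}  p = refl
count≡sum {ℕ.suc n} p = cong (ℕ._+_ (if p zero then 1 else 0)) (count≡sum (p ∘ suc))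

emptyGraph : ∀ n → SignedGraph n
emptyGraph n = record
  { A = λ _ _ → + 0 ; entries = λ _ _ → inj₂ (inj₂ refl) ; symmetric = λ _ _ → refl ; loopless = λ _ → refl }

forwardDegree : ∀ {n} → SignedGraph n → Fin n → ℕ
forwardDegree Γ u = count (λ j → ⌊ u <? j ⌋ ∧ isEdge (A Γ u j))

-- edgeCount sums with a function local to its where-block; unification names it edgeSum. That
-- function never uses its graph parameter, so emptyGraph n can stand in for every graph.
mutual
  edgeSum : ∀ {m} → (Fin m → ℕ) → ℕ
  edgeSum = _

  private
    edgeCount-emptyGraph : ∀ n → edgeCount (emptyGraph n) ≡ edgeSum (forwardDegree (emptyGraph n))
    edgeCount-emptyGraph n with forwardDegree (emptyGraph n)
    ... | f = refl

edgeSum≡sum : ∀ {m} (f : Fin m → ℕ) → edgeSum f ≡ ℕΣ.sum f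
edgeSum≡sum {ℕ.zero}  f = refl
edgeSum≡sum {ℕ.suc m} f = cong (ℕ._+_ (f zero)) (edgeSum≡sum (f ∘ suc))

module _ {n} (Γ : SignedGraph n) where

  adjacent-sym : ∀ {u j} → Adjacent Γ u j → Adjacent Γ j u
  adjacent-sym {u} {j} u~j = u~j ∘ trans (symmetric Γ u j)

  edgeIndicator forwardEdgeIndicator : Fin n → Fin n → ℕ
  edgeIndicator        u j = if isEdge (A Γ u j) then 1 else 0
  forwardEdgeIndicator u j = if ⌊ u <? j ⌋ ∧ isEdge (A Γ u j) then 1 else 0

  adjacent⇒edgeIndicator≡1 : ∀ {u j} → Adjacent Γ u j → edgeIndicator u j ≡ 1
  adjacent⇒edgeIndicator≡1 {u} {j} u~j with A Γ u j ℤ.≟ + 0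
  ... | yes Auj≡0 = ⊥-elim (u~j Auj≡0)
  ... | no  _     = refl

  edgeCount≡doubleSum : edgeCount Γ ≡ doubleSum forwardEdgeIndicator
  edgeCount≡doubleSum = trans (edgeSum≡sum (forwardDegree Γ))
    (ℕΣ.sum-cong-≗ {n} (λ u → count≡sum (λ j → ⌊ u <? j ⌋ ∧ isEdge (A Γ u j))))

  edgeIndicator-split : ∀ u j → edgeIndicator u j ≡ forwardEdgeIndicator u j ℕ.+ forwardEdgeIndicator j u
  edgeIndicator-split u j with u <? j | j <? u
  ... | yes u<j | yes j<u = ⊥-elim (FinP.<-asym u<j j<u)
  ... | yes _   | no _    = sym (ℕP.+-identityʳ _)
  ... | no _    | yes _   = cong (λ x → if isEdge x then 1 else 0) (symmetric Γ u j)
  ... | no u≮j  | no j≮u with FinP.<-cmp u j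
  ...   | tri< u<j _ _  = ⊥-elim (u≮j u<j)
  ...   | tri> _ _ j<u  = ⊥-elim (j≮u j<u)
  ...   | tri≈ _ refl _ = cong (λ x → if isEdge x then 1 else 0) (loopless Γ u)

  handshake : doubleSum edgeIndicator ≡ edgeCount Γ ℕ.+ edgeCount Γ
  handshake = begin
    doubleSum edgeIndicator
      ≡⟨ doubleSum-cong edgeIndicator-split ⟩
    doubleSum (λ u j → forwardEdgeIndicator u j ℕ.+ forwardEdgeIndicator j u)
      ≡⟨ doubleSum-symmetrise forwardEdgeIndicator ⟩
    doubleSum forwardEdgeIndicator ℕ.+ doubleSum forwardEdgeIndicator
      ≡⟨ sym (cong₂ ℕ._+_ edgeCount≡doubleSum edgeCount≡doubleSum) ⟩
    edgeCount Γ ℕ.+ edgeCount Γ ∎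
    where open ≡-Reasoning

module _ {n} (Γ : SignedGraph n) where

  weight : Fin n → Fin n → ℚ
  weight u j = toℚ (A Γ u j)

  weight-sym : ∀ u j → weight u j ≡ weight j u
  weight-sym u j = cong toℚ (symmetric Γ u j)

  nonadjacent⇒weight≡0 : ∀ {u j} → ¬ Adjacent Γ u j → weight u j ≡ 0ℚ
  nonadjacent⇒weight≡0 {u} {j} u≁j with A Γ u j ℤ.≟ + 0
  ... | yes Auj≡0 = cong toℚ Auj≡0
  ... | no  Auj≢0 = ⊥-elim (u≁j Auj≢0)

  adjacent⇒weight²≡1 : ∀ {u j} → Adjacent Γ u j → weight u j * weight u j ≡ 1ℚ
  adjacent⇒weight²≡1 {u} {j} u~j with entries Γ u j
  ... | inj₁ Auj≡1         rewrite Auj≡1  = refl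
  ... | inj₂ (inj₁ Auj≡-1) rewrite Auj≡-1 = refl
  ... | inj₂ (inj₂ Auj≡0)  = ⊥-elim (u~j Auj≡0)

  toℚ-netDegree : ∀ u → toℚ (netDegree Γ u) ≡ sum (weight u)
  toℚ-netDegree u = sym (sum-signs (A Γ u) (entries Γ u))

  private
    toℚ-netLaplacian-* : ∀ (x : Fin n → ℚ) u j →
      toℚ (netLaplacian Γ u j) * x j ≡ when (j ≟ u) (toℚ (netDegree Γ u) * x j) - weight u j * x j
    toℚ-netLaplacian-* x u j with u ≟ j | j ≟ u
    ... | yes refl | yes _    = trans (cong (_* x u) (toℚ-sub (netDegree Γ u) (A Γ u u)))
      (solve 3 (λ d w y → (d :- w) :* y := d :* y :- w :* y) refl (toℚ (netDegree Γ u)) (weight u u) (x u))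
    ... | no _     | no _     = trans (cong (_* x j) (toℚ-neg (A Γ u j)))
      (solve 2 (λ w y → (:- w) :* y := con 0ℚ :- w :* y) refl (weight u j) (x j))
    ... | yes refl | no u≢u   = ⊥-elim (u≢u refl)
    ... | no u≢j   | yes refl = ⊥-elim (u≢j refl)

  laplacian-row : ∀ (x : Fin n → ℚ) u →
                  sumℚ (λ j → toℚ (netLaplacian Γ u j) * x j) ≡ ∑[ j < n ] (weight u j * (x u - x j))
  laplacian-row x u = begin
    sumℚ (λ j → toℚ (netLaplacian Γ u j) * x j)
      ≡⟨ sumℚ≡sum (λ j → toℚ (netLaplacian Γ u j) * x j) ⟩
    ∑[ j < n ] (toℚ (netLaplacian Γ u j) * x j)
      ≡⟨ sum-cong-≗ {n} (toℚ-netLaplacian-* x u) ⟩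
    ∑[ j < n ] (when (j ≟ u) (d * x j) - weight u j * x j)
      ≡⟨ sum-sub (λ j → when (j ≟ u) (d * x j)) (λ j → weight u j * x j) ⟩
    ∑[ j < n ] when (j ≟ u) (d * x j) - Σwx
      ≡⟨ cong (_- Σwx) (trans (sum-when-≡ u (λ j → d * x j)) (cong (_* x u) (toℚ-netDegree u))) ⟩
    sum (weight u) * x u - Σwx
      ≡⟨ cong (_- Σwx) (*-distribʳ-sum (x u) (weight u)) ⟩
    ∑[ j < n ] (weight u j * x u) - Σwx
      ≡⟨ sym (sum-sub (λ j → weight u j * x u) (λ j → weight u j * x j)) ⟩
    ∑[ j < n ] (weight u j * x u - weight u j * x j)
      ≡⟨ sum-cong-≗ {n} (λ j → solve 3 (λ w y z → w :* y :- w :* z := w :* (y :- z))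
                                        refl (weight u j) (x u) (x j)) ⟩
    ∑[ j < n ] (weight u j * (x u - x j)) ∎
    where
    open ≡-Reasoning
    d = toℚ (netDegree Γ u)
    Σwx = ∑[ j < n ] (weight u j * x j)

-- Out-orientations

record OutOrientation {n} (Γ : SignedGraph n) : Set where
  field
    out          : Fin n → Fin n
    adjacent-out : ∀ u → Adjacent Γ u (out u)
    out∘out≢id   : ∀ u → out (out u) ≢ u

module _ {n} {Γ : SignedGraph n} (o : OutOrientation Γ) where
  open OutOrientation o

  private
    outIndicator : Fin n → Fin n → ℕ
    outIndicator u j = if does (j ≟ out u) then 1 else 0

    outEdgeIndicator≤edgeIndicator : ∀ u j → outIndicator u j ℕ.+ outIndicator j u ≤ edgeIndicator Γ u j
    outEdgeIndicator≤edgeIndicator u j with j ≟ out u | u ≟ out j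
    ... | yes refl | yes u≡out-j = ⊥-elim (out∘out≢id u (sym u≡out-j))
    ... | yes refl | no _        = ℕP.≤-reflexive (sym (adjacent⇒edgeIndicator≡1 Γ (adjacent-out u)))
    ... | no _     | yes refl    = ℕP.≤-reflexive (sym (adjacent⇒edgeIndicator≡1 Γ (adjacent-sym Γ (adjacent-out j))))
    ... | no _     | no _        = z≤n

    -- Double counting: u ↦ {u, out u} is injective, so when |E| = |V| it hits every edge.
    outEdgeIndicator≡edgeIndicator : edgeCount Γ ≡ n →
                                     ∀ u j → outIndicator u j ℕ.+ outIndicator j u ≡ edgeIndicator Γ u j
    outEdgeIndicator≡edgeIndicator |E|≡n =
      doubleSum-squeeze outEdgeIndicator≤edgeIndicator (ℕP.≤-reflexive (begin
        doubleSum (edgeIndicator Γ)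
          ≡⟨ handshake Γ ⟩
        edgeCount Γ ℕ.+ edgeCount Γ
          ≡⟨ cong₂ ℕ._+_ |E|≡n |E|≡n ⟩
        n ℕ.+ n
          ≡⟨ sym (cong₂ ℕ._+_ outIndicator-rows outIndicator-rows) ⟩
        doubleSum outIndicator ℕ.+ doubleSum outIndicator
          ≡⟨ sym (doubleSum-symmetrise outIndicator) ⟩
        doubleSum (λ u j → outIndicator u j ℕ.+ outIndicator j u) ∎))
      where
      open ≡-Reasoning
      outIndicator-rows : doubleSum outIndicator ≡ n
      outIndicator-rows = doubleSum-rows≡1 (λ u → sum-δ ℕP.+-0-monoid (out u) (λ _ → 1))

  adjacent⇒out-edge : edgeCount Γ ≡ n → ∀ {u j} → Adjacent Γ u j → j ≡ out u ⊎ u ≡ out j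
  adjacent⇒out-edge |E|≡n {u} {j} u~j with j ≟ out u | u ≟ out j | outEdgeIndicator≡edgeIndicator |E|≡n u j
  ... | yes j≡out-u | _           | _      = inj₁ j≡out-u
  ... | no _        | yes u≡out-j | _      = inj₂ u≡out-j
  ... | no _        | no _        | 0≡edge with () ← trans 0≡edge (adjacent⇒edgeIndicator≡1 Γ u~j)

module Flow {n} {Γ : SignedGraph n} (o : OutOrientation Γ) (|E|≡n : edgeCount Γ ≡ n) where
  open OutOrientation o

  flow : (Fin n → ℚ) → Fin n → ℚ
  flow x u = weight Γ u (out u) * (x u - x (out u))

  inflow : (Fin n → ℚ) → Fin n → ℚ
  inflow ψ u = ∑[ j < n ] when (u ≟ out j) (ψ j)

  private
    edge-term : ∀ x u j → weight Γ u j * (x u - x j) ≡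
                when (j ≟ out u) (weight Γ u j * (x u - x j)) - when (u ≟ out j) (flow x j)
    edge-term x u j with j ≟ out u | u ≟ out j
    ... | yes refl | yes u≡out-j = ⊥-elim (out∘out≢id u (sym u≡out-j))
    ... | yes refl | no _        = sym (ℚP.+-identityʳ _)
    ... | no _     | yes refl    = trans (cong (_* (x (out j) - x j)) (weight-sym Γ (out j) j))
      (solve 3 (λ w y z → w :* (y :- z) := con 0ℚ :- w :* (z :- y)) refl (weight Γ j (out j)) (x (out j)) (x j))
    ... | no j≢out-u | no u≢out-j =
      trans (cong (_* (x u - x j)) (nonadjacent⇒weight≡0 Γ u≁j)) (ℚP.*-zeroˡ (x u - x j))
      where
      u≁j : ¬ Adjacent Γ u j
      u≁j u~j with adjacent⇒out-edge o |E|≡n u~j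
      ... | inj₁ j≡out-u = j≢out-u j≡out-u
      ... | inj₂ u≡out-j = u≢out-j u≡out-j

  laplacian-flow : ∀ x u → sumℚ (λ j → toℚ (netLaplacian Γ u j) * x j) ≡ flow x u - inflow (flow x) u
  laplacian-flow x u = begin
    sumℚ (λ j → toℚ (netLaplacian Γ u j) * x j)
      ≡⟨ laplacian-row Γ x u ⟩
    ∑[ j < n ] (weight Γ u j * (x u - x j))
      ≡⟨ sum-cong-≗ {n} (edge-term x u) ⟩
    ∑[ j < n ] (when (j ≟ out u) (weight Γ u j * (x u - x j)) - when (u ≟ out j) (flow x j))
      ≡⟨ sum-sub (λ j → when (j ≟ out u) (weight Γ u j * (x u - x j))) (λ j → when (u ≟ out j) (flow x j)) ⟩
    ∑[ j < n ] when (j ≟ out u) (weight Γ u j * (x u - x j)) - inflow (flow x) u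
      ≡⟨ cong (_- inflow (flow x) u) (sum-when-≡ (out u) (λ j → weight Γ u j * (x u - x j))) ⟩
    flow x u - inflow (flow x) u ∎
    where open ≡-Reasoning

  kernel⇒conservation : ∀ {x} → Kernel (netLaplacian Γ) x → ∀ u → flow x u ≡ inflow (flow x) u
  kernel⇒conservation {x} x∈ker u = x∙y⁻¹≈ε⇒x≈y _ _ (trans (sym (laplacian-flow x u)) (x∈ker u))

  inflow-zero : ∀ ψ u → (∀ j → out j ≡ u → ψ j ≡ 0ℚ) → inflow ψ u ≡ 0ℚ
  inflow-zero ψ u children-zero = sum-zero term-zero
    where
    term-zero : ∀ j → when (u ≟ out j) (ψ j) ≡ 0ℚ
    term-zero j with u ≟ out j
    ... | yes u≡out-j = children-zero j (sym u≡out-j)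
    ... | no  _       = refl

  flow≡0⇒out-invariant : ∀ z u → flow z u ≡ 0ℚ → z u ≡ z (out u)
  flow≡0⇒out-invariant z u flow≡0 = x∙y⁻¹≈ε⇒x≈y (z u) (z (out u)) (begin
    z u - z (out u)   ≡⟨ sym (*-cancel-square≡1 w (adjacent⇒weight²≡1 Γ (adjacent-out u)) (z u - z (out u))) ⟩
    w * flow z u      ≡⟨ cong (w *_) flow≡0 ⟩
    w * 0ℚ            ≡⟨ ℚP.*-zeroʳ w ⟩
    0ℚ                ∎)
    where
    open ≡-Reasoning
    w = weight Γ u (out u)

  flow≡0⇒constant : Connected Γ → ∀ z → (∀ u → flow z u ≡ 0ℚ) → ∀ u v → z u ≡ z v
  flow≡0⇒constant connected z flow≡0 u v = along (connected u v)
    where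
    across : ∀ {u j} → Adjacent Γ u j → z u ≡ z j
    across {u} u~j with adjacent⇒out-edge o |E|≡n u~j
    ... | inj₁ refl = flow≡0⇒out-invariant z u (flow≡0 u)
    ... | inj₂ refl = sym (flow≡0⇒out-invariant z _ (flow≡0 _))
    along : ∀ {u v} → Walk Γ u v → z u ≡ z v
    along here            = refl
    along (step u~j walk) = trans (across u~j) (along walk)

-- Unicyclic graphs

least-witness : ∀ {p} {P : ℕ → Set p} → (∀ t → Dec (P t)) → ∀ {t} → P t →
                ∃ λ m → P m × (∀ {s} → s < m → ¬ P s)
least-witness P? {ℕ.zero}  P0 = ℕ.zero , P0 , λ ()
least-witness P? {ℕ.suc t} Pt with P? ℕ.zero
... | yes P0  = ℕ.zero , P0 , λ ()
... | no  ¬P0 with least-witness (λ s → P? (ℕ.suc s)) Pt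
...   | m , Pm , below-m = ℕ.suc m , Pm , λ { {ℕ.zero} _ → ¬P0 ; {ℕ.suc s} (s≤s s<m) → below-m s<m }

module CycleOrientation {n} {U : SignedGraph n} (connected : Connected U) (C : Cycle U) where

  Index : Set
  Index = Fin (3 ℕ.+ m C)

  v : Index → Fin n
  v = verts C

  OnCycle : Fin n → Set
  OnCycle u = ∃ λ i → v i ≡ u

  onCycle? : ∀ u → Dec (OnCycle u)
  onCycle? u = FinP.any? (λ i → v i ≟ u)

  WithinDistance : ℕ → Fin n → Set
  WithinDistance ℕ.zero    u = OnCycle u
  WithinDistance (ℕ.suc t) u = WithinDistance t u ⊎ ∃ λ j → Adjacent U u j × WithinDistance t j

  withinDistance? : ∀ t u → Dec (WithinDistance t u)
  withinDistance? ℕ.zero    u = onCycle? u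
  withinDistance? (ℕ.suc t) u =
    withinDistance? t u ⊎-dec FinP.any? (λ j → ¬? (A U u j ℤ.≟ + 0) ×-dec withinDistance? t j)

  walk⇒withinDistance : ∀ {u w} → Walk U u w → OnCycle w → ∃ λ t → WithinDistance t u
  walk⇒withinDistance here            w∈C = ℕ.zero , w∈C
  walk⇒withinDistance (step u~j walk) w∈C with walk⇒withinDistance walk w∈C
  ... | t , j-near = ℕ.suc t , inj₂ (_ , u~j , j-near)

  private
    nearest : ∀ u → ∃ λ d → WithinDistance d u × (∀ {s} → s < d → ¬ WithinDistance s u)
    nearest u = least-witness (λ t → withinDistance? t u)
                  (proj₂ (walk⇒withinDistance (connected u (v zero)) (zero , refl)))

  distance : Fin n → ℕ
  distance u = proj₁ (nearest u)

  distance-≤ : ∀ {t u} → WithinDistance t u → distance u ≤ t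
  distance-≤ {t} {u} u-near = ℕP.≮⇒≥ (λ t<d → proj₂ (proj₂ (nearest u)) t<d u-near)

  closer-neighbour : ∀ u → ¬ OnCycle u → ∃ λ j → Adjacent U u j × distance j < distance u
  closer-neighbour u u∉C = descend (distance u) (proj₁ (proj₂ (nearest u))) (proj₂ (proj₂ (nearest u)))
    where
    descend : ∀ d → WithinDistance d u → (∀ {s} → s < d → ¬ WithinDistance s u) →
              ∃ λ j → Adjacent U u j × distance j < d
    descend ℕ.zero    u∈C                       _       = ⊥-elim (u∉C u∈C)
    descend (ℕ.suc d) (inj₁ u-near)             minimal = ⊥-elim (minimal ℕP.≤-refl u-near)
    descend (ℕ.suc d) (inj₂ (j , u~j , j-near)) _       = j , u~j , s≤s (distance-≤ j-near)

  distanceBound : ℕ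
  distanceBound = ℕΣ.sum distance

  distance≤distanceBound : ∀ u → distance u ≤ distanceBound
  distance≤distanceBound = ≤-sum distance

  -- out and retract are opaque so that splitting on onCycle? u elsewhere leaves them intact.
  opaque
    out : Fin n → Fin n
    out u with onCycle? u
    ... | yes (i , _) = v (next i)
    ... | no u∉C      = proj₁ (closer-neighbour u u∉C)

    out-v : ∀ i → out (v i) ≡ v (next i)
    out-v i with onCycle? (v i)
    ... | yes (i′ , vi′≡vi) = cong (v ∘ next) (inj C i′ i vi′≡vi)
    ... | no  vi∉C          = ⊥-elim (vi∉C (i , refl))

    out-closer : ∀ u → ¬ OnCycle u → distance (out u) < distance u
    out-closer u u∉C with onCycle? u
    ... | yes u∈C  = ⊥-elim (u∉C u∈C)
    ... | no  u∉C′ = proj₂ (proj₂ (closer-neighbour u u∉C′))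

    adjacent-out : ∀ u → Adjacent U u (out u)
    adjacent-out u with onCycle? u
    ... | yes (i , refl) = adj C i
    ... | no  u∉C        = proj₁ (proj₂ (closer-neighbour u u∉C))

  out-onCycle : ∀ {u} → OnCycle u → OnCycle (out u)
  out-onCycle (i , refl) = next i , sym (out-v i)

  child-off-cycle : ∀ {j u} → out j ≡ u → ¬ OnCycle u → ¬ OnCycle j
  child-off-cycle out-j≡u u∉C j∈C = u∉C (subst OnCycle out-j≡u (out-onCycle j∈C))

  private
    out∘out≢id-cases : ∀ u → Dec (OnCycle u) → Dec (OnCycle (out u)) → out (out u) ≢ u
    out∘out≢id-cases u (yes (i , vi≡u)) _ out²u≡u = next∘next≢id i (inj C _ _ (begin
      v (next (next i))   ≡⟨ sym (trans (cong out (out-v i)) (out-v (next i))) ⟩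
      out (out (v i))     ≡⟨ cong (out ∘ out) vi≡u ⟩
      out (out u)         ≡⟨ out²u≡u ⟩
      u                   ≡⟨ sym vi≡u ⟩
      v i                 ∎))
      where open ≡-Reasoning
    out∘out≢id-cases u (no u∉C) (yes out-u∈C) out²u≡u =
      u∉C (subst OnCycle out²u≡u (out-onCycle out-u∈C))
    out∘out≢id-cases u (no u∉C) (no out-u∉C)  out²u≡u = ℕP.<-irrefl refl (ℕP.<-trans
      (subst (λ w → distance w < distance (out u)) out²u≡u (out-closer (out u) out-u∉C)) (out-closer u u∉C))

  out∘out≢id : ∀ u → out (out u) ≢ u
  out∘out≢id u = out∘out≢id-cases u (onCycle? u) (onCycle? (out u))

  orientation : OutOrientation U
  orientation = record { out = out ; adjacent-out = adjacent-out ; out∘out≢id = out∘out≢id }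

  -- retract t u follows out at most t times; its fallback value zero is never reached once
  -- distance u ≤ t.
  opaque
    retract : ℕ → Fin n → Index
    retract t u with onCycle? u
    retract t         u | yes (i , _) = i
    retract ℕ.zero    u | no _        = zero
    retract (ℕ.suc t) u | no _        = retract t (out u)

    retract-v : ∀ t i → retract t (v i) ≡ i
    retract-v t i with onCycle? (v i)
    ... | yes (i′ , vi′≡vi) = inj C i′ i vi′≡vi
    ... | no  vi∉C          = ⊥-elim (vi∉C (i , refl))

    retract-out : ∀ t u → ¬ OnCycle u → retract (ℕ.suc t) u ≡ retract t (out u)
    retract-out t u u∉C with onCycle? u
    ... | yes u∈C = ⊥-elim (u∉C u∈C)
    ... | no  _   = refl

    retract-stable : ∀ t u → distance u ≤ t → retract t u ≡ retract (ℕ.suc t) u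
    retract-stable t u d≤t with onCycle? u
    retract-stable t         u d≤t | yes _   = refl
    retract-stable ℕ.zero    u d≤0 | no  u∉C = ⊥-elim (ℕP.n≮0 (ℕP.<-≤-trans (out-closer u u∉C) d≤0))
    retract-stable (ℕ.suc t) u d≤t | no  u∉C =
      retract-stable t (out u) (ℕP.≤-pred (ℕP.<-≤-trans (out-closer u u∉C) d≤t))

  root : Fin n → Index
  root = retract (ℕ.suc distanceBound)

  root-v : ∀ i → root (v i) ≡ i
  root-v = retract-v (ℕ.suc distanceBound)

  root-out : ∀ u → ¬ OnCycle u → root u ≡ root (out u)
  root-out u u∉C = trans (retract-out distanceBound u u∉C) (retract-stable distanceBound (out u)
    (ℕP.≤-trans (ℕP.<⇒≤ (out-closer u u∉C)) (distance≤distanceBound u)))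

-- The kernel of the net Laplacian of a unicyclic graph

module UnicyclicKernel {n} {U : SignedGraph n} (connected : Connected U) (|E|≡n : edgeCount U ≡ n)
                       (C : Cycle U) where
  open CycleOrientation connected C
  open Flow orientation |E|≡n

  InKernel : (Fin n → ℚ) → Set
  InKernel = Kernel (netLaplacian U)

  inflow-v-next : ∀ ψ → (∀ j → ¬ OnCycle j → ψ j ≡ 0ℚ) → ∀ i → inflow ψ (v (next i)) ≡ ψ (v i)
  inflow-v-next ψ ψ-on-cycle i = trans (sum-cong-≗ {n} term) (sum-when-≡ (v i) ψ)
    where
    term : ∀ j → when (v (next i) ≟ out j) (ψ j) ≡ when (j ≟ v i) (ψ j)
    term j with onCycle? j
    ... | yes (i′ , refl) = when-⇔ (v (next i) ≟ out (v i′)) (v i′ ≟ v i)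
      (λ e → cong v (sym (next-injective (inj C _ _ (trans e (out-v i′))))))
      (λ e → trans (cong (v ∘ next) (sym (inj C _ _ e))) (sym (out-v i′))) (ψ (v i′))
    ... | no j∉C rewrite ψ-on-cycle j j∉C = trans (when-0 (v (next i) ≟ out j)) (sym (when-0 (j ≟ v i)))

  -- Induction from the leaves inwards: children of u lie farther from C, and distances are bounded.
  flow-off-cycle : ∀ {x} → InKernel x → ∀ u → ¬ OnCycle u → flow x u ≡ 0ℚ
  flow-off-cycle {x} x∈ker u u∉C = inwards distanceBound u u∉C (ℕP.m≤m+n distanceBound (distance u))
    where
    inwards : ∀ slack u → ¬ OnCycle u → distanceBound ≤ slack ℕ.+ distance u → flow x u ≡ 0ℚ
    inwards slack u u∉C bound≤ = trans (kernel⇒conservation x∈ker u) (inflow-zero (flow x) u child)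
      where
      child : ∀ j → out j ≡ u → flow x j ≡ 0ℚ
      child j out-j≡u = by-slack slack bound≤
        where
        j∉C = child-off-cycle out-j≡u u∉C
        farther : distance u < distance j
        farther = subst (λ w → distance w < distance j) out-j≡u (out-closer j j∉C)
        by-slack : ∀ slack → distanceBound ≤ slack ℕ.+ distance u → flow x j ≡ 0ℚ
        by-slack ℕ.zero       bound≤ = ⊥-elim (ℕP.<-irrefl refl
          (ℕP.<-≤-trans farther (ℕP.≤-trans (distance≤distanceBound j) bound≤)))
        by-slack (ℕ.suc less) bound≤ = inwards less j j∉C (ℕP.≤-trans bound≤
          (ℕP.≤-trans (ℕP.≤-reflexive (sym (ℕP.+-suc less (distance u)))) (ℕP.+-monoʳ-≤ less farther)))

  flow-on-cycle : ∀ {x} → InKernel x → ∀ i → flow x (v i) ≡ flow x (v zero)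
  flow-on-cycle {x} x∈ker = next-invariant⇒constant (flow x ∘ v) (λ i →
    trans (kernel⇒conservation x∈ker (v (next i))) (inflow-v-next (flow x) (flow-off-cycle x∈ker) i))

  flow≡0-everywhere : ∀ {x} → InKernel x → flow x (v zero) ≡ 0ℚ → ∀ u → flow x u ≡ 0ℚ
  flow≡0-everywhere {x} x∈ker flow-v₀≡0 u with onCycle? u
  ... | yes (i , refl) = trans (flow-on-cycle x∈ker i) flow-v₀≡0
  ... | no  u∉C        = flow-off-cycle x∈ker u u∉C

  σ : Index → ℚ
  σ i = toℚ (cycleEdgeSign C i)

  σ²≡1 : ∀ i → σ i * σ i ≡ 1ℚ
  σ²≡1 i = adjacent⇒weight²≡1 U (adj C i)

  flow-v : ∀ x i → flow x (v i) ≡ σ i * (x (v i) - x (v (next i)))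
  flow-v x i = cong (λ w → weight U (v i) w * (x (v i) - x w)) (out-v i)

  sum-σ : sum σ ≡ toℚ (+ m⁺ C ℤ.- + m⁻ C)
  sum-σ = sum-signs (cycleEdgeSign C) (λ i → entries U _ _)

  sum-σ≡0⇔m⁺≡m⁻ : (sum σ ≡ 0ℚ → m⁺ C ≡ m⁻ C) × (m⁺ C ≡ m⁻ C → sum σ ≡ 0ℚ)
  sum-σ≡0⇔m⁺≡m⁻ =
      (λ Σσ≡0 → ℤP.+-injective (ℤP.i-j≡0⇒i≡j _ _ (toℚ≡0⇒≡0 _ (trans (sym sum-σ) Σσ≡0))))
    , (λ m⁺≡m⁻ → trans sum-σ (cong toℚ (trans (cong (λ k → + m⁺ C ℤ.- + k) (sym m⁺≡m⁻))
                                               (ℤP.+-inverseʳ (+ m⁺ C)))))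

  -- Multiplying by σ i turns the flow along cycle edge i into a difference, which telescopes.
  flow*sum-σ≡0 : ∀ {x} → InKernel x → flow x (v zero) * sum σ ≡ 0ℚ
  flow*sum-σ≡0 {x} x∈ker = begin
    c * sum σ                              ≡⟨ *-distribˡ-sum c σ ⟩
    ∑[ i < 3 ℕ.+ m C ] (c * σ i)           ≡⟨ sum-cong-≗ {3 ℕ.+ m C} telescope ⟩
    ∑[ i < 3 ℕ.+ m C ] (y i - y (next i))  ≡⟨ sum-sub y (y ∘ next) ⟩
    sum y - sum (y ∘ next)                 ≡⟨ cong (_-_ (sum y)) (sum-next ℚP.+-0-commutativeMonoid y) ⟩
    sum y - sum y                          ≡⟨ ℚP.+-inverseʳ (sum y) ⟩
    0ℚ                                     ∎
    where
    open ≡-Reasoning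
    c = flow x (v zero)
    y = x ∘ v
    telescope : ∀ i → c * σ i ≡ y i - y (next i)
    telescope i = begin
      c * σ i                           ≡⟨ ℚP.*-comm c (σ i) ⟩
      σ i * c                           ≡⟨ cong (σ i *_) (trans (sym (flow-on-cycle x∈ker i)) (flow-v x i)) ⟩
      σ i * (σ i * (y i - y (next i)))  ≡⟨ *-cancel-square≡1 (σ i) (σ²≡1 i) (y i - y (next i)) ⟩
      y i - y (next i)                  ∎

  ones∈kernel : InKernel (λ _ → 1ℚ)
  ones∈kernel u = trans (laplacian-row U (λ _ → 1ℚ) u) (sum-zero (λ j → ℚP.*-zeroʳ (weight U u j)))

  unbalanced⇒η≡1 : sum σ ≢ 0ℚ → η≡ U 1
  unbalanced⇒η≡1 Σσ≢0 = (λ _ _ → 1ℚ) , (λ _ → ones∈kernel) , independent , spanning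
    where
    r≡r*1+0 : ∀ r → r ≡ r * 1ℚ + 0ℚ
    r≡r*1+0 = solve 1 (λ r → r := r :* con 1ℚ :+ con 0ℚ) refl
    independent : ∀ c → (∀ u → c zero * 1ℚ + 0ℚ ≡ 0ℚ) → ∀ t → c t ≡ 0ℚ
    independent c combination≡0 zero = trans (r≡r*1+0 (c zero)) (combination≡0 (v zero))
    spanning : ∀ x → InKernel x → ∃ λ c → ∀ u → x u ≡ c zero * 1ℚ + 0ℚ
    spanning x x∈ker = (λ _ → x (v zero)) , λ u → trans (flow≡0⇒constant connected x flow≡0 u (v zero))
                                                         (r≡r*1+0 (x (v zero)))
      where
      flow≡0 = flow≡0-everywhere x∈ker (p*q≡0⇒p≡0 Σσ≢0 (flow*sum-σ≡0 x∈ker))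

  module Balanced (Σσ≡0 : sum σ ≡ 0ℚ) where

    private
      P : Index → ℚ
      P = proj₁ (cyclic-potential σ Σσ≡0)

      P-zero : P zero ≡ 0ℚ
      P-zero = proj₁ (proj₂ (cyclic-potential σ Σσ≡0))

      P-step : ∀ i → P i - P (next i) ≡ σ i
      P-step = proj₂ (proj₂ (cyclic-potential σ Σσ≡0))

    -- Constant on each tree hanging off C, so its flow is 1 along C and 0 elsewhere.
    circulation : Fin n → ℚ
    circulation = P ∘ root

    circulation-v₀ : circulation (v zero) ≡ 0ℚ
    circulation-v₀ = trans (cong P (root-v zero)) P-zero

    circulation-v₁ : circulation (v (next zero)) ≡ - σ zero
    circulation-v₁ = begin
      P (root (v (next zero)))             ≡⟨ cong P (root-v (next zero)) ⟩
      P (next zero)                        ≡⟨ solve 2 (λ p q → q := :- (p :- q) :+ p) refl (P zero) (P (next zero)) ⟩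
      - (P zero - P (next zero)) + P zero  ≡⟨ cong₂ (λ a b → - a + b) (P-step zero) P-zero ⟩
      - σ zero + 0ℚ                        ≡⟨ ℚP.+-identityʳ (- σ zero) ⟩
      - σ zero                             ∎
      where open ≡-Reasoning

    flow-circulation-off : ∀ u → ¬ OnCycle u → flow circulation u ≡ 0ℚ
    flow-circulation-off u u∉C = begin
      w * (P (root u) - P (root (out u)))         ≡⟨ cong (λ r → w * (P r - P (root (out u)))) (root-out u u∉C) ⟩
      w * (P (root (out u)) - P (root (out u)))   ≡⟨ cong (w *_) (ℚP.+-inverseʳ (P (root (out u)))) ⟩
      w * 0ℚ                                       ≡⟨ ℚP.*-zeroʳ w ⟩
      0ℚ                                           ∎
      where
      open ≡-Reasoning
      w = weight U u (out u)

    flow-circulation-v : ∀ i → flow circulation (v i) ≡ 1ℚ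
    flow-circulation-v i = begin
      flow circulation (v i)                         ≡⟨ flow-v circulation i ⟩
      σ i * (P (root (v i)) - P (root (v (next i))))
                                                     ≡⟨ cong₂ (λ a b → σ i * (P a - P b)) (root-v i) (root-v (next i)) ⟩
      σ i * (P i - P (next i))                       ≡⟨ cong (σ i *_) (P-step i) ⟩
      σ i * σ i                                      ≡⟨ σ²≡1 i ⟩
      1ℚ                                             ∎
      where open ≡-Reasoning

    circulation∈kernel : InKernel circulation
    circulation∈kernel u = trans (laplacian-flow circulation u) (by-position (onCycle? u))
      where
      by-position : Dec (OnCycle u) → flow circulation u - inflow (flow circulation) u ≡ 0ℚ
      by-position (yes (i , refl)) = begin
        flow circulation (v i) - inflow (flow circulation) (v i)
          ≡⟨ cong (λ j → flow circulation (v i) - inflow (flow circulation) (v j)) (sym (next-prev i)) ⟩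
        flow circulation (v i) - inflow (flow circulation) (v (next (prev i)))
          ≡⟨ cong (_-_ (flow circulation (v i))) (inflow-v-next (flow circulation) flow-circulation-off (prev i)) ⟩
        flow circulation (v i) - flow circulation (v (prev i))
          ≡⟨ cong₂ _-_ (flow-circulation-v i) (flow-circulation-v (prev i)) ⟩
        1ℚ - 1ℚ
          ≡⟨ ℚP.+-inverseʳ 1ℚ ⟩
        0ℚ ∎
        where open ≡-Reasoning
      by-position (no u∉C) = begin
        flow circulation u - inflow (flow circulation) u
          ≡⟨ cong₂ _-_ (flow-circulation-off u u∉C) (inflow-zero (flow circulation) u (λ j out-j≡u →
               flow-circulation-off j (child-off-cycle out-j≡u u∉C))) ⟩
        0ℚ - 0ℚ
          ≡⟨ ℚP.+-inverseʳ 0ℚ ⟩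
        0ℚ ∎
        where open ≡-Reasoning

    basis : Fin 2 → Fin n → ℚ
    basis zero       = λ _ → 1ℚ
    basis (suc zero) = circulation

    -- sumℚ (λ t → c t * basis t u), in the form it computes to.
    combination : (Fin 2 → ℚ) → Fin n → ℚ
    combination c u = c zero * 1ℚ + (c (suc zero) * circulation u + 0ℚ)

    basis-independent : ∀ c → (∀ u → combination c u ≡ 0ℚ) → ∀ t → c t ≡ 0ℚ
    basis-independent c combination≡0 = λ { zero → c₀≡0 ; (suc zero) → c₁≡0 }
      where
      open ≡-Reasoning
      c₀≡0 : c zero ≡ 0ℚ
      c₀≡0 = begin
        c zero
          ≡⟨ solve 2 (λ a b → a := a :* con 1ℚ :+ (b :* con 0ℚ :+ con 0ℚ)) refl (c zero) (c (suc zero)) ⟩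
        c zero * 1ℚ + (c (suc zero) * 0ℚ + 0ℚ)
          ≡⟨ cong (λ p → c zero * 1ℚ + (c (suc zero) * p + 0ℚ)) (sym circulation-v₀) ⟩
        combination c (v zero)
          ≡⟨ combination≡0 (v zero) ⟩
        0ℚ ∎
      -σ₀≢0 : - σ zero ≢ 0ℚ
      -σ₀≢0 -σ₀≡0 = ℚP.1≢0 (begin
        1ℚ                       ≡⟨ sym (σ²≡1 zero) ⟩
        σ zero * σ zero          ≡⟨ solve 1 (λ s → s :* s := (:- s) :* (:- s)) refl (σ zero) ⟩
        (- σ zero) * (- σ zero)  ≡⟨ cong (λ s → s * s) -σ₀≡0 ⟩
        0ℚ                       ∎)
      c₁≡0 : c (suc zero) ≡ 0ℚ
      c₁≡0 = p*q≡0⇒p≡0 -σ₀≢0 (begin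
        c (suc zero) * - σ zero
          ≡⟨ solve 2 (λ b s → b :* s := con 0ℚ :* con 1ℚ :+ (b :* s :+ con 0ℚ)) refl (c (suc zero)) (- σ zero) ⟩
        0ℚ * 1ℚ + (c (suc zero) * - σ zero + 0ℚ)
          ≡⟨ cong₂ (λ a p → a * 1ℚ + (c (suc zero) * p + 0ℚ)) (sym c₀≡0) (sym circulation-v₁) ⟩
        combination c (v (next zero))
          ≡⟨ combination≡0 (v (next zero)) ⟩
        0ℚ ∎)

    basis-spanning : ∀ x → InKernel x → ∃ λ c → ∀ u → x u ≡ combination c u
    basis-spanning x x∈ker = c , λ u → x∙y⁻¹≈ε⇒x≈y (x u) (combination c u)
      (trans (flow≡0⇒constant connected z flow-z≡0 u (v zero)) z-v₀≡0)
      where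
      c : Fin 2 → ℚ
      c zero       = x (v zero)
      c (suc zero) = flow x (v zero)
      z : Fin n → ℚ
      z u = x u - combination c u
      flow-z : ∀ u → flow z u ≡ flow x u - c (suc zero) * flow circulation u
      flow-z u = solve 7 (λ a xu xo c₀ c₁ wu wo →
          a :* ((xu :- (c₀ :* con 1ℚ :+ (c₁ :* wu :+ con 0ℚ)))
                :- (xo :- (c₀ :* con 1ℚ :+ (c₁ :* wo :+ con 0ℚ))))
          := a :* (xu :- xo) :- c₁ :* (a :* (wu :- wo))) refl
        (weight U u (out u)) (x u) (x (out u)) (c zero) (c (suc zero)) (circulation u) (circulation (out u))
      flow-z≡0 : ∀ u → flow z u ≡ 0ℚ
      flow-z≡0 u with onCycle? u
      ... | yes (i , refl) = trans (flow-z (v i))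
        (trans (cong₂ (λ p q → p - c (suc zero) * q) (flow-on-cycle x∈ker i) (flow-circulation-v i))
               (solve 1 (λ a → a :- a :* con 1ℚ := con 0ℚ) refl (c (suc zero))))
      ... | no u∉C = trans (flow-z u)
        (trans (cong₂ (λ p q → p - c (suc zero) * q) (flow-off-cycle x∈ker u u∉C) (flow-circulation-off u u∉C))
               (solve 1 (λ a → con 0ℚ :- a :* con 0ℚ := con 0ℚ) refl (c (suc zero))))
      z-v₀≡0 : z (v zero) ≡ 0ℚ
      z-v₀≡0 = trans (cong (λ p → c zero - (c zero * 1ℚ + (c (suc zero) * p + 0ℚ))) circulation-v₀)
        (solve 2 (λ a b → a :- (a :* con 1ℚ :+ (b :* con 0ℚ :+ con 0ℚ)) := con 0ℚ) refl (c zero) (c (suc zero)))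

    balanced⇒η≡2 : η≡ U 2
    balanced⇒η≡2 = basis , (λ { zero → ones∈kernel ; (suc zero) → circulation∈kernel })
                 , basis-independent , basis-spanning

lemma3p2 : (n : ℕ) (U : SignedGraph n) → Unicyclic U → (C : Cycle U) →
             (m⁺ C ≢ m⁻ C → η≡ U 1) × (m⁺ C ≡ m⁻ C → η≡ U 2)
lemma3p2 n U (connected , |E|≡n) C =
    (λ m⁺≢m⁻ → unbalanced⇒η≡1 (m⁺≢m⁻ ∘ proj₁ sum-σ≡0⇔m⁺≡m⁻))
  , (λ m⁺≡m⁻ → Balanced.balanced⇒η≡2 (proj₂ sum-σ≡0⇔m⁺≡m⁻ m⁺≡m⁻))
  where open UnicyclicKernel connected |E|≡n C
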